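{- Let $\mathbf p=(p_1,\dots,p_n)$ and $\mathbf q=(q_1,\dots,q_m)$ be nonincreasing sequences of nonnegative integers, each summing to $N$, and let $T:\operatorname{Mat}_{n\times n}(\mathbb{C})\to\operatorname{Mat}_{m\times m}(\mathbb{C})$ be completely positive. For every invertible upper-triangular $g_0\in\operatorname{Mat}_{m\times m}(\mathbb{C})$ and invertible upper-triangular $h_0\in\operatorname{Mat}_{n\times n}(\mathbb{C})$, $$\operatorname{trun}_{P,Q}(T_{g_0,h_0})=(\operatorname{trun}_{P,Q}T)_{G_{\mathbf q}(g_0),\,G_{\mathbf p}(h_0)}.$$
   Context: For a completely positive map $S(X)=\sum_iA_iXA_i^\dagger$, $S^*(Y)=\sum_iA_i^\dagger YA_i$ and $S_{g,h}(X)=g^\dagger S(hXh^\dagger)g$. For a nonincreasing sequence $\lambda=(\lambda_1,\dots,\lambda_k)$ of nonnegative integers summing to $l$, let $\lambda'$ be its conjugate partition ($\lambda'_i=\#\{j:\lambda_j\ge i\}$), let $\eta_j$ be the $j\times k$ matrix $[I_j\ 0]$, and define $G_\lambda:\operatorname{Mat}_{k\times k}(\mathbb{C})\to\operatorname{Mat}_{l\times l}(\mathbb{C})$ by $G_\lambda(X)=\bigoplus_{i=1}^{\lambda_1}\eta_{\lambda'_i}X\eta_{\lambda'_i}^\dagger$ (block-diagonal). With $P=\operatorname{diag}(\mathbf p)$, $Q=\operatorname{diag}(\mathbf q)$, define $\operatorname{trun}_{P,Q}T=G_{\mathbf q}\circ T\circ G_{\mathbf p}^*:\operatorname{Mat}_{N\times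 N}(\mathbb{C})\to\operatorname{Mat}_{N\times N}(\mathbb{C})$. -}

module Defs where

open import Level using (Level; _⊔_)
open import Algebra.Bundles using (CommutativeRing)
open import Data.Nat as ℕ using (ℕ; zero; suc; _≤_; _≤?_)
open import Data.Fin as Fin using (Fin; zero; suc; toℕ; splitAt)
open import Data.Sum using (inj₁; inj₂)
open import Data.Product using (Σ; _×_)
open import Data.Vec as Vec using (Vec; []; _∷_)
open import Data.List as List using (List; []; _∷_)
open import Data.Nat.ListAction renaming (sum to sumL)
open import Relation.Nullary using (does)
open import Data.Bool using (if_then_else_)

-- A commutative ring with an involutive ring automorphism (conjugation).
-- ℂ with complex conjugation is the instance relevant to the paper.
record StarCommRing (c ℓ : Level) : Set (Level.suc (c ⊔ ℓ)) where
  field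
    commRing : CommutativeRing c ℓ
  open CommutativeRing commRing public
  field
    conj            : Carrier → Carrier
    conj-cong       : ∀ {x y} → x ≈ y → conj x ≈ conj y
    conj-involutive : ∀ x → conj (conj x) ≈ x
    conj-+          : ∀ x y → conj (x + y) ≈ conj x + conj y
    conj-*          : ∀ x y → conj (x * y) ≈ conj x * conj y
    conj-1          : conj 1# ≈ 1#

first : ∀ {k} → Vec ℕ k → ℕ
first []      = 0
first (x ∷ _) = x

conjPart : ∀ {k} → Vec ℕ k → ℕ → ℕ
conjPart λs i = Vec.count (λ x → i ≤? x) λs

conjList : ∀ {k} → Vec ℕ k → List ℕ
conjList λs = List.map (λ i → conjPart λs (suc i)) (List.upTo (first λs))

NonIncreasing : ∀ {k} → Vec ℕ k → Set
NonIncreasing {k} λs = ∀ (i j : Fin k) → toℕ i ≤ toℕ j → Vec.lookup λs j ≤ Vec.lookup λs i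

module MatOps {c ℓ} (R : StarCommRing c ℓ) where
  open StarCommRing R using (Carrier; _≈_; _+_; _*_; 0#; 1#; conj)

  Mat : ℕ → ℕ → Set c
  Mat m n = Fin m → Fin n → Carrier

  Σ[_] : ∀ n → (Fin n → Carrier) → Carrier
  Σ[ zero ] f  = 0#
  Σ[ suc n ] f = f zero + Σ[ n ] (λ i → f (suc i))

  infixl 7 _⊛_
  _⊛_ : ∀ {m n p} → Mat m n → Mat n p → Mat m p
  (A ⊛ B) i j = Σ[ _ ] (λ k → A i k * B k j)

  _† : ∀ {m n} → Mat m n → Mat n m
  (A †) i j = conj (A j i)

  _⊕_ : ∀ {m n} → Mat m n → Mat m n → Mat m n
  (A ⊕ B) i j = A i j + B i j

  zeroM : ∀ {m n} → Mat m n
  zeroM _ _ = 0#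

  idM : ∀ {n} → Mat n n
  idM i j = if does (i Fin.≟ j) then 1# else 0#

  ΣM[_] : ∀ r {m n} → (Fin r → Mat m n) → Mat m n
  ΣM[ r ] F i j = Σ[ r ] (λ s → F s i j)

  infix 4 _≈M_
  _≈M_ : ∀ {m n} → Mat m n → Mat m n → Set ℓ
  A ≈M B = ∀ i j → A i j ≈ B i j

  UpperTriangular : ∀ {n} → Mat n n → Set ℓ
  UpperTriangular {n} g = ∀ (i j : Fin n) → toℕ j ℕ.< toℕ i → g i j ≈ 0#

  Invertible : ∀ {n} → Mat n n → Set (c ⊔ ℓ)
  Invertible {n} g = Σ (Mat n n) λ g' → (g ⊛ g' ≈M idM) × (g' ⊛ g ≈M idM)

  -- completely positive: Kraus form  T(X) = Σ_i A_i X A_i†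
  CompletelyPositive : ∀ {n m} → (Mat n n → Mat m m) → Set (c ⊔ ℓ)
  CompletelyPositive {n} {m} T =
    Σ ℕ λ r → Σ (Fin r → Mat m n) λ A →
      ∀ X → T X ≈M ΣM[ r ] (λ i → A i ⊛ X ⊛ (A i †))

  twist : ∀ {n m} → (Mat n n → Mat m m) → Mat m m → Mat n n → Mat n n → Mat m m
  twist S g h X = (g †) ⊛ S (h ⊛ X ⊛ (h †)) ⊛ g

  η : ∀ j k → Mat j k
  η j k a b = if does (toℕ a ℕ.≟ toℕ b) then 1# else 0#

  blockDiag : (ds : List ℕ) → ((i : Fin (List.length ds)) → Mat (List.lookup ds i) (List.lookup ds i))
            → Mat (sumL ds) (sumL ds)
  blockDiag [] B ()
  blockDiag (d ∷ ds) B r s with splitAt d r | splitAt d s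
  ... | inj₁ a | inj₁ b = B zero a b
  ... | inj₂ a | inj₂ b = blockDiag ds (λ i → B (suc i)) a b
  ... | _      | _      = 0#

  embed : (ds : List ℕ) (i : Fin (List.length ds)) → Fin (List.lookup ds i) → Fin (sumL ds)
  embed (d ∷ ds) zero    a = a Fin.↑ˡ sumL ds
  embed (d ∷ ds) (suc i) a = d Fin.↑ʳ embed ds i a

  ι : (ds : List ℕ) (i : Fin (List.length ds)) → Mat (sumL ds) (List.lookup ds i)
  ι ds i r a = if does (r Fin.≟ embed ds i a) then 1# else 0#

  G : ∀ {k} (λs : Vec ℕ k) → Mat k k → Mat (sumL (conjList λs)) (sumL (conjList λs))
  G {k} λs X = blockDiag (conjList λs)
    (λ i → η (List.lookup (conjList λs) i) k ⊛ X ⊛ (η (List.lookup (conjList λs) i) k †))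

  -- Kraus operators of G_λ: E_i = ι_i η_{λ'_i}, so G_λ(X) = Σ_i E_i X E_i†
  Gkraus : ∀ {k} (λs : Vec ℕ k) (i : Fin (List.length (conjList λs)))
         → Mat (sumL (conjList λs)) k
  Gkraus {k} λs i = ι (conjList λs) i ⊛ η (List.lookup (conjList λs) i) k

  G* : ∀ {k} (λs : Vec ℕ k) → Mat (sumL (conjList λs)) (sumL (conjList λs)) → Mat k k
  G* λs Y = ΣM[ _ ] (λ i → (Gkraus λs i †) ⊛ Y ⊛ Gkraus λs i)

  trun : ∀ {n m} (p : Vec ℕ n) (q : Vec ℕ m) → (Mat n n → Mat m m)
       → Mat (sumL (conjList p)) (sumL (conjList p))
       → Mat (sumL (conjList q)) (sumL (conjList q))
  trun p q T Y = G q (T (G* p Y))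

-- Everything rests on one fact: an upper-triangular g leaves the span of the first
-- j basis vectors invariant, i.e.  η† (η g η†) = g η†  (corner-invariant).  Hence
--   * corners, and so G, are multiplicative on twists: G(g)† G(Z) G(g) = G(g† Z g);
--   * each E_i intertwines G(h) with h, so G*(G(h) Y G(h)†) = h G*(Y) h†.
-- Substituting both into the definitions proves the theorem.
module Submission where

open import Defs
open import Data.Nat using (ℕ)
open import Data.Vec using (Vec; sum)
open import Relation.Binary.PropositionalEquality using (_≡_)

open import Data.Nat as ℕ using (zero; suc)
import Data.Nat.Properties as ℕₚ
open import Data.Fin using (Fin; zero; suc; toℕ; _↑ˡ_; _↑ʳ_; splitAt)
open import Data.Fin.Properties
  using (splitAt-↑ˡ; splitAt-↑ʳ; ↑ˡ-injective; ↑ʳ-injective; toℕ<n) renaming (_≟_ to _≟ᶠ_)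
open import Data.Bool using (Bool; true; false; if_then_else_)
open import Data.List using (List; []; _∷_; length; lookup)
open import Data.Nat.ListAction using () renaming (sum to sumL)
open import Data.Product using (_,_)
open import Relation.Nullary using (does; yes; no)
open import Relation.Nullary.Decidable using (does-⇔; dec-false)
open import Function.Bundles using (mk⇔)
open import Function using (_∘_)
open import Relation.Binary.Bundles using (Setoid)
import Relation.Binary.PropositionalEquality as ≡
open ≡ using (_≢_)
import Algebra.Properties.Semiring.Sum as SemiringSum
import Relation.Binary.Reasoning.Setoid as SetoidReasoning

module Truncation {c ℓ} (R : StarCommRing c ℓ) where
  open StarCommRing R hiding (zero)
  open MatOps R
  open SemiringSum semiring using (∑-comm; *-distribˡ-sum; *-distribʳ-sum)
    renaming (sum to ∑)
  module ScalarReasoning = SetoidReasoning setoid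

  ≈-via : ∀ {x x' y y'} → x ≡ x' → y ≡ y' → x' ≈ y' → x ≈ y
  ≈-via ≡.refl ≡.refl e = e

  conj-0 : conj 0# ≈ 0#
  conj-0 = begin
    conj 0#                  ≈⟨ conj-cong (sym (zeroˡ (conj 0#))) ⟩
    conj (0# * conj 0#)      ≈⟨ conj-* _ _ ⟩
    conj 0# * conj (conj 0#) ≈⟨ *-congˡ (conj-involutive 0#) ⟩
    conj 0# * 0#             ≈⟨ zeroʳ _ ⟩
    0#                       ∎
    where open ScalarReasoning

  δ : Bool → Carrier
  δ b = if b then 1# else 0#

  -- indicator entries are real, so η, ι and their adjoints have the same entries
  conj-δ : ∀ b → conj (δ b) ≈ δ b
  conj-δ true  = conj-1
  conj-δ false = conj-0

  -- The sum Σ[ n ] of Defs is the library's semiring sum, so its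
  -- algebra (distributivity, exchange of summations) can be imported.
  Σ≡∑ : ∀ n (f : Fin n → Carrier) → Σ[ n ] f ≡ ∑ f
  Σ≡∑ zero    f = ≡.refl
  Σ≡∑ (suc n) f = ≡.cong (f zero +_) (Σ≡∑ n (λ i → f (suc i)))

  Σ-cong : ∀ n {f g : Fin n → Carrier} → (∀ i → f i ≈ g i) → Σ[ n ] f ≈ Σ[ n ] g
  Σ-cong zero    e = refl
  Σ-cong (suc n) e = +-cong (e zero) (Σ-cong n (λ i → e (suc i)))

  Σ-zero : ∀ n {f : Fin n → Carrier} → (∀ i → f i ≈ 0#) → Σ[ n ] f ≈ 0#
  Σ-zero zero    e = refl
  Σ-zero (suc n) e = trans (+-cong (e zero) (Σ-zero n (λ i → e (suc i)))) (+-identityˡ 0#)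

  Σ-*ˡ : ∀ n x (f : Fin n → Carrier) → x * Σ[ n ] f ≈ Σ[ n ] (λ i → x * f i)
  Σ-*ˡ n x f = ≈-via (≡.cong (x *_) (Σ≡∑ n f)) (Σ≡∑ n _) (*-distribˡ-sum x f)

  Σ-*ʳ : ∀ n x (f : Fin n → Carrier) → Σ[ n ] f * x ≈ Σ[ n ] (λ i → f i * x)
  Σ-*ʳ n x f = ≈-via (≡.cong (_* x) (Σ≡∑ n f)) (Σ≡∑ n _) (*-distribʳ-sum x f)

  Σ-comm : ∀ m n (f : Fin m → Fin n → Carrier) →
           Σ[ m ] (λ i → Σ[ n ] (f i)) ≈ Σ[ n ] (λ j → Σ[ m ] (λ i → f i j))
  Σ-comm m n f = begin
    Σ[ m ] (λ i → Σ[ n ] (f i))         ≈⟨ Σ-cong m (λ i → reflexive (Σ≡∑ n (f i))) ⟩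
    Σ[ m ] (λ i → ∑ (f i))              ≡⟨ Σ≡∑ m _ ⟩
    ∑ (λ i → ∑ (f i))                   ≈⟨ ∑-comm f ⟩
    ∑ (λ j → ∑ (λ i → f i j))           ≡⟨ Σ≡∑ n _ ⟨
    Σ[ n ] (λ j → ∑ (λ i → f i j))      ≈⟨ Σ-cong n (λ j → reflexive (≡.sym (Σ≡∑ m _))) ⟩
    Σ[ n ] (λ j → Σ[ m ] (λ i → f i j)) ∎
    where open ScalarReasoning

  Σ-conj : ∀ n (f : Fin n → Carrier) → conj (Σ[ n ] f) ≈ Σ[ n ] (λ i → conj (f i))
  Σ-conj zero    f = conj-0
  Σ-conj (suc n) f = trans (conj-+ _ _) (+-congˡ (Σ-conj n _))

  Σ-split : ∀ d e (f : Fin (d ℕ.+ e) → Carrier) →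
            Σ[ d ℕ.+ e ] f ≈ Σ[ d ] (λ a → f (a ↑ˡ e)) + Σ[ e ] (λ b → f (d ↑ʳ b))
  Σ-split zero    e f = sym (+-identityˡ _)
  Σ-split (suc d) e f = trans (+-congˡ (Σ-split d e (λ i → f (suc i)))) (sym (+-assoc _ _ _))

  matSetoid : ℕ → ℕ → Setoid c ℓ
  matSetoid m n = record
    { Carrier       = Mat m n
    ; _≈_           = _≈M_
    ; isEquivalence = record
      { refl  = λ _ _ → refl
      ; sym   = λ e i j → sym (e i j)
      ; trans = λ e f i j → trans (e i j) (f i j)
      }
    }

  module ≈M {m n} = Setoid (matSetoid m n)
  module MatReasoning {m n} = SetoidReasoning (matSetoid m n)

  -- the inner dimension of a product cannot be inferred from a goal _≈M_,
  -- so it is an explicit argument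
  ⊛-cong : ∀ {m p} n {A A' : Mat m n} {B B' : Mat n p} → A ≈M A' → B ≈M B' → A ⊛ B ≈M A' ⊛ B'
  ⊛-cong n a b i j = Σ-cong n (λ k → *-cong (a i k) (b k j))

  ⊛-assoc : ∀ {m n p q} (A : Mat m n) (B : Mat n p) (C : Mat p q) → A ⊛ B ⊛ C ≈M A ⊛ (B ⊛ C)
  ⊛-assoc {n = n} {p = p} A B C i j = begin
    Σ[ p ] (λ k → Σ[ n ] (λ l → A i l * B l k) * C k j)   ≈⟨ Σ-cong p (λ k → Σ-*ʳ n _ _) ⟩
    Σ[ p ] (λ k → Σ[ n ] (λ l → A i l * B l k * C k j))   ≈⟨ Σ-comm p n _ ⟩
    Σ[ n ] (λ l → Σ[ p ] (λ k → A i l * B l k * C k j))   ≈⟨ Σ-cong n (λ l → Σ-cong p (λ k → *-assoc _ _ _)) ⟩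
    Σ[ n ] (λ l → Σ[ p ] (λ k → A i l * (B l k * C k j))) ≈⟨ Σ-cong n (λ l → Σ-*ˡ p _ _) ⟨
    Σ[ n ] (λ l → A i l * Σ[ p ] (λ k → B l k * C k j))   ∎
    where open ScalarReasoning

  †-cong : ∀ {m n} {A A' : Mat m n} → A ≈M A' → A † ≈M A' †
  †-cong a i j = conj-cong (a j i)

  †-involutive : ∀ {m n} (A : Mat m n) → A † † ≈M A
  †-involutive A i j = conj-involutive (A i j)

  †-⊛ : ∀ {m n p} (A : Mat m n) (B : Mat n p) → (A ⊛ B) † ≈M B † ⊛ A †
  †-⊛ {n = n} A B i j = trans (Σ-conj n _) (Σ-cong n (λ k → trans (conj-* _ _) (*-comm _ _)))

  ΣM-cong : ∀ r {m n} {F F' : Fin r → Mat m n} → (∀ s → F s ≈M F' s) → ΣM[ r ] F ≈M ΣM[ r ] F'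
  ΣM-cong r e i j = Σ-cong r (λ s → e s i j)

  ⊛-ΣMˡ : ∀ r {m n p} (A : Mat m n) (F : Fin r → Mat n p) → A ⊛ ΣM[ r ] F ≈M ΣM[ r ] (λ s → A ⊛ F s)
  ⊛-ΣMˡ r {n = n} A F i j = trans (Σ-cong n (λ k → Σ-*ˡ r _ _)) (Σ-comm n r _)

  ΣM-⊛ʳ : ∀ r {m n p} (F : Fin r → Mat m n) (B : Mat n p) → ΣM[ r ] F ⊛ B ≈M ΣM[ r ] (λ s → F s ⊛ B)
  ΣM-⊛ʳ r {n = n} F B i j = trans (Σ-cong n (λ k → Σ-*ʳ r _ _)) (Σ-comm n r _)

  intertwine-† : ∀ {m n} (A : Mat m n) (M : Mat m m) (g : Mat n n) →
                 A † ⊛ M ≈M g ⊛ A † → M † ⊛ A ≈M A ⊛ g †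
  intertwine-† {m} {n} A M g e = begin
    M † ⊛ A         ≈⟨ ⊛-cong m ≈M.refl (†-involutive A) ⟨
    M † ⊛ A † †     ≈⟨ †-⊛ (A †) M ⟨
    (A † ⊛ M) †     ≈⟨ †-cong e ⟩
    (g ⊛ A †) †     ≈⟨ †-⊛ g (A †) ⟩
    A † † ⊛ g †     ≈⟨ ⊛-cong n (†-involutive A) ≈M.refl ⟩
    A ⊛ g †         ∎
    where open MatReasoning

  ⊛-regroup : ∀ {m₁ m₂ m₃ m₄ m₅ m₆} (A : Mat m₁ m₂) (B : Mat m₂ m₃) (C : Mat m₃ m₄)
              (D : Mat m₄ m₅) (E : Mat m₅ m₆) → A ⊛ (B ⊛ C ⊛ D) ⊛ E ≈M A ⊛ B ⊛ C ⊛ (D ⊛ E)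
  ⊛-regroup {m₂ = m₂} {m₃} {m₄} {m₅} A B C D E = begin
    A ⊛ (B ⊛ C ⊛ D) ⊛ E     ≈⟨ ⊛-cong m₅ (⊛-assoc A (B ⊛ C) D) ≈M.refl ⟨
    A ⊛ (B ⊛ C) ⊛ D ⊛ E     ≈⟨ ⊛-assoc (A ⊛ (B ⊛ C)) D E ⟩
    A ⊛ (B ⊛ C) ⊛ (D ⊛ E)   ≈⟨ ⊛-cong m₄ (⊛-assoc A B C) ≈M.refl ⟨
    A ⊛ B ⊛ C ⊛ (D ⊛ E)     ∎
    where open MatReasoning

  sandwich-slide : ∀ {m₁ m₂ m₃ m₄ m₅ m₆ k₁ k₂}
    {A : Mat m₁ m₂} {B : Mat m₂ m₃} {C : Mat m₃ m₄} {D : Mat m₄ m₅} {E : Mat m₅ m₆}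
    {B' : Mat m₁ k₁} {A' : Mat k₁ m₃} {D' : Mat m₄ k₂} {E' : Mat k₂ m₆} →
    A ⊛ B ≈M B' ⊛ A' → D ⊛ E ≈M D' ⊛ E' → A ⊛ (B ⊛ C ⊛ D) ⊛ E ≈M B' ⊛ (A' ⊛ C ⊛ D') ⊛ E'
  sandwich-slide {m₄ = m₄} {A = A} {B} {C} {D} {E} {B'} {A'} {D'} {E'} ab de = begin
    A ⊛ (B ⊛ C ⊛ D) ⊛ E     ≈⟨ ⊛-regroup A B C D E ⟩
    A ⊛ B ⊛ C ⊛ (D ⊛ E)     ≈⟨ ⊛-cong m₄ (⊛-cong _ ab ≈M.refl) de ⟩
    B' ⊛ A' ⊛ C ⊛ (D' ⊛ E') ≈⟨ ⊛-regroup B' A' C D' E' ⟨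
    B' ⊛ (A' ⊛ C ⊛ D') ⊛ E' ∎
    where open MatReasoning

  data Side (d e : ℕ) : Fin (d ℕ.+ e) → Set where
    left  : (a : Fin d) → Side d e (a ↑ˡ e)
    right : (b : Fin e) → Side d e (d ↑ʳ b)

  side : ∀ d e (r : Fin (d ℕ.+ e)) → Side d e r
  side zero    e r       = right r
  side (suc d) e zero    = left zero
  side (suc d) e (suc r) with side d e r
  ... | left a  = left (suc a)
  ... | right b = right b

  Blocks : List ℕ → Set c
  Blocks ds = (i : Fin (length ds)) → Mat (lookup ds i) (lookup ds i)

  module Quadrants {d : ℕ} {ds : List ℕ} (B : Blocks (d ∷ ds)) where
    private e = sumL ds

    ll : ∀ a b → blockDiag (d ∷ ds) B (a ↑ˡ e) (b ↑ˡ e) ≡ B zero a b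
    ll a b rewrite splitAt-↑ˡ d a e | splitAt-↑ˡ d b e = ≡.refl

    lr : ∀ a b → blockDiag (d ∷ ds) B (a ↑ˡ e) (d ↑ʳ b) ≡ 0#
    lr a b rewrite splitAt-↑ˡ d a e | splitAt-↑ʳ d e b = ≡.refl

    rl : ∀ a b → blockDiag (d ∷ ds) B (d ↑ʳ a) (b ↑ˡ e) ≡ 0#
    rl a b rewrite splitAt-↑ʳ d e a | splitAt-↑ˡ d b e = ≡.refl

    rr : ∀ a b → blockDiag (d ∷ ds) B (d ↑ʳ a) (d ↑ʳ b) ≡ blockDiag ds (λ i → B (suc i)) a b
    rr a b rewrite splitAt-↑ʳ d e a | splitAt-↑ʳ d e b = ≡.refl

  open Quadrants

  blockDiag-cong : ∀ ds {B B' : Blocks ds} → (∀ i → B i ≈M B' i) → blockDiag ds B ≈M blockDiag ds B'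
  blockDiag-cong []       e ()
  blockDiag-cong (d ∷ ds) {B} {B'} e r s with side d (sumL ds) r | side d (sumL ds) s
  ... | left a  | left b  = ≈-via (ll B a b) (ll B' a b) (e zero a b)
  ... | left a  | right b = ≈-via (lr B a b) (lr B' a b) refl
  ... | right a | left b  = ≈-via (rl B a b) (rl B' a b) refl
  ... | right a | right b = ≈-via (rr B a b) (rr B' a b) (blockDiag-cong ds (λ i → e (suc i)) a b)

  blockDiag-† : ∀ ds (B : Blocks ds) → blockDiag ds B † ≈M blockDiag ds (λ i → B i †)
  blockDiag-† []       B ()
  blockDiag-† (d ∷ ds) B r s with side d (sumL ds) r | side d (sumL ds) s
  ... | left a  | left b  = ≈-via (≡.cong conj (ll B b a)) (ll B† a b) refl
    where B† = λ i → B i †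
  ... | left a  | right b = ≈-via (≡.cong conj (rl B b a)) (lr B† a b) conj-0
    where B† = λ i → B i †
  ... | right a | left b  = ≈-via (≡.cong conj (lr B b a)) (rl B† a b) conj-0
    where B† = λ i → B i †
  ... | right a | right b = ≈-via (≡.cong conj (rr B b a)) (rr B† a b)
                                  (blockDiag-† ds (λ i → B (suc i)) a b)
    where B† = λ i → B i †

  module BlockRows {d : ℕ} {ds : List ℕ} (A B : Blocks (d ∷ ds)) where
    private
      e = sumL ds
      X = blockDiag (d ∷ ds) A
      Y = blockDiag (d ∷ ds) B

    ⊛-row-left : ∀ a s → (X ⊛ Y) (a ↑ˡ e) s ≈ Σ[ d ] (λ t → A zero a t * Y (t ↑ˡ e) s)
    ⊛-row-left a s = trans (Σ-split d e _) (trans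
      (+-cong (Σ-cong d (λ t → *-congʳ (reflexive (ll A a t))))
              (Σ-zero e (λ t → trans (*-congʳ (reflexive (lr A a t))) (zeroˡ _))))
      (+-identityʳ _))

    ⊛-row-right : ∀ a s →
      (X ⊛ Y) (d ↑ʳ a) s ≈ Σ[ e ] (λ t → blockDiag ds (λ i → A (suc i)) a t * Y (d ↑ʳ t) s)
    ⊛-row-right a s = trans (Σ-split d e _) (trans
      (+-cong (Σ-zero d (λ t → trans (*-congʳ (reflexive (rl A a t))) (zeroˡ _)))
              (Σ-cong e (λ t → *-congʳ (reflexive (rr A a t)))))
      (+-identityˡ _))

  open BlockRows

  blockDiag-⊛ : ∀ ds (A B : Blocks ds) →
                blockDiag ds A ⊛ blockDiag ds B ≈M blockDiag ds (λ i → A i ⊛ B i)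
  blockDiag-⊛ []       A B ()
  blockDiag-⊛ (d ∷ ds) A B r s with side d (sumL ds) r | side d (sumL ds) s
  ... | left a  | left b  = trans (⊛-row-left A B a s)
    (≈-via ≡.refl (ll AB a b) (Σ-cong d (λ t → *-congˡ (reflexive (ll B t b)))))
    where AB = λ i → A i ⊛ B i
  ... | left a  | right b = trans (⊛-row-left A B a s)
    (≈-via ≡.refl (lr AB a b) (Σ-zero d (λ t → trans (*-congˡ (reflexive (lr B t b))) (zeroʳ _))))
    where AB = λ i → A i ⊛ B i
  ... | right a | left b  = trans (⊛-row-right A B a s)
    (≈-via ≡.refl (rl AB a b) (Σ-zero (sumL ds) (λ t → trans (*-congˡ (reflexive (rl B t b))) (zeroʳ _))))
    where AB = λ i → A i ⊛ B i
  ... | right a | right b = trans (⊛-row-right A B a s)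
    (≈-via ≡.refl (rr AB a b) (trans (Σ-cong (sumL ds) (λ t → *-congˡ (reflexive (rr B t b))))
                                     (blockDiag-⊛ ds (λ i → A (suc i)) (λ i → B (suc i)) a b)))
    where AB = λ i → A i ⊛ B i

  blockDiag-sandwich : ∀ ds (C D : Blocks ds) →
    blockDiag ds C † ⊛ blockDiag ds D ⊛ blockDiag ds C ≈M blockDiag ds (λ i → C i † ⊛ D i ⊛ C i)
  blockDiag-sandwich ds C D = begin
    blockDiag ds C † ⊛ blockDiag ds D ⊛ blockDiag ds C
      ≈⟨ ⊛-cong S (⊛-cong S (blockDiag-† ds C) ≈M.refl) ≈M.refl ⟩
    blockDiag ds (λ i → C i †) ⊛ blockDiag ds D ⊛ blockDiag ds C
      ≈⟨ ⊛-cong S (blockDiag-⊛ ds (λ i → C i †) D) ≈M.refl ⟩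
    blockDiag ds (λ i → C i † ⊛ D i) ⊛ blockDiag ds C
      ≈⟨ blockDiag-⊛ ds (λ i → C i † ⊛ D i) C ⟩
    blockDiag ds (λ i → C i † ⊛ D i ⊛ C i) ∎
    where open MatReasoning
          S = sumL ds

  ↑ˡ≢↑ʳ : ∀ {d e} (x : Fin d) (y : Fin e) → x ↑ˡ e ≢ d ↑ʳ y
  ↑ˡ≢↑ʳ {d} {e} x y eq with
    ≡.trans (≡.sym (splitAt-↑ˡ d x e)) (≡.trans (≡.cong (splitAt d) eq) (splitAt-↑ʳ d e y))
  ... | ()

  ↑ˡ-≟ : ∀ {d} e (x y : Fin d) → does (x ↑ˡ e ≟ᶠ y ↑ˡ e) ≡ does (x ≟ᶠ y)
  ↑ˡ-≟ e x y = does-⇔ (mk⇔ (↑ˡ-injective e x y) (≡.cong (_↑ˡ e))) (x ↑ˡ e ≟ᶠ y ↑ˡ e) (x ≟ᶠ y)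

  ↑ʳ-≟ : ∀ d {e} (x y : Fin e) → does (d ↑ʳ x ≟ᶠ d ↑ʳ y) ≡ does (x ≟ᶠ y)
  ↑ʳ-≟ d x y = does-⇔ (mk⇔ (↑ʳ-injective d x y) (≡.cong (d ↑ʳ_))) (d ↑ʳ x ≟ᶠ d ↑ʳ y) (x ≟ᶠ y)

  Σ-δˡ : ∀ n (x : Fin n) (f : Fin n → Carrier) → Σ[ n ] (λ r → δ (does (r ≟ᶠ x)) * f r) ≈ f x
  Σ-δˡ (suc n) zero    f = trans (+-cong (*-identityˡ _) (Σ-zero n (λ r → zeroˡ _))) (+-identityʳ _)
  Σ-δˡ (suc n) (suc x) f = trans (+-cong (zeroˡ _) (Σ-δˡ n x (λ r → f (suc r)))) (+-identityˡ _)

  Σ-δʳ : ∀ n (x : Fin n) (f : Fin n → Carrier) → Σ[ n ] (λ r → f r * δ (does (x ≟ᶠ r))) ≈ f x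
  Σ-δʳ (suc n) zero    f = trans (+-cong (*-identityʳ _) (Σ-zero n (λ r → zeroʳ _))) (+-identityʳ _)
  Σ-δʳ (suc n) (suc x) f = trans (+-cong (zeroʳ _) (Σ-δʳ n x (λ r → f (suc r)))) (+-identityˡ _)

  *-δ-cong : ∀ x {b b'} → b ≡ b' → x * δ b ≈ x * δ b'
  *-δ-cong x eq = *-congˡ (reflexive (≡.cong δ eq))

  *-δ-false : ∀ x {b} → b ≡ false → x * δ b ≈ 0#
  *-δ-false x ≡.refl = zeroʳ x

  blockDiag-embed-row : ∀ ds (B : Blocks ds) (i : Fin (length ds)) a s →
    blockDiag ds B (embed ds i a) s ≈ Σ[ lookup ds i ] (λ b → B i a b * δ (does (s ≟ᶠ embed ds i b)))
  blockDiag-embed-row (d ∷ ds) B zero a s with side d (sumL ds) s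
  ... | left s'  = ≈-via (ll B a s') ≡.refl (sym (trans
        (Σ-cong d (λ b → *-δ-cong _ (↑ˡ-≟ (sumL ds) s' b)))
        (Σ-δʳ d s' (B zero a))))
  ... | right s' = ≈-via (lr B a s') ≡.refl (sym (Σ-zero d (λ b →
        *-δ-false _ (dec-false (d ↑ʳ s' ≟ᶠ b ↑ˡ sumL ds) (↑ˡ≢↑ʳ b s' ∘ ≡.sym)))))
  blockDiag-embed-row (d ∷ ds) B (suc i) a s with side d (sumL ds) s
  ... | left s'  = ≈-via (rl B _ s') ≡.refl (sym (Σ-zero (lookup ds i) (λ b →
        *-δ-false _ (dec-false (s' ↑ˡ _ ≟ᶠ d ↑ʳ embed ds i b) (↑ˡ≢↑ʳ s' (embed ds i b))))))
  ... | right s' = ≈-via (rr B _ s') ≡.refl (trans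
        (blockDiag-embed-row ds (λ j → B (suc j)) i a s')
        (Σ-cong (lookup ds i) (λ b → *-δ-cong _ (≡.sym (↑ʳ-≟ d s' (embed ds i b))))))

  ι-intertwine : ∀ ds (B : Blocks ds) i → ι ds i † ⊛ blockDiag ds B ≈M B i ⊛ ι ds i †
  ι-intertwine ds B i a s = begin
    Σ[ sumL ds ] (λ r → conj (δ (does (r ≟ᶠ embed ds i a))) * blockDiag ds B r s)
      ≈⟨ Σ-cong (sumL ds) (λ r → *-congʳ (conj-δ _)) ⟩
    Σ[ sumL ds ] (λ r → δ (does (r ≟ᶠ embed ds i a)) * blockDiag ds B r s)
      ≈⟨ Σ-δˡ (sumL ds) (embed ds i a) (λ r → blockDiag ds B r s) ⟩
    blockDiag ds B (embed ds i a) s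
      ≈⟨ blockDiag-embed-row ds B i a s ⟩
    Σ[ lookup ds i ] (λ b → B i a b * δ (does (s ≟ᶠ embed ds i b)))
      ≈⟨ Σ-cong (lookup ds i) (λ b → *-congˡ (conj-δ _)) ⟨
    (B i ⊛ ι ds i †) a s ∎
    where open ScalarReasoning

  δℕ : ℕ → ℕ → Carrier
  δℕ u v = δ (does (u ℕ.≟ v))

  δℕ-sym : ∀ u v → δℕ u v ≡ δℕ v u
  δℕ-sym u v = ≡.cong δ (does-⇔ (mk⇔ ≡.sym ≡.sym) (u ℕ.≟ v) (v ℕ.≟ u))

  pick : ∀ k → (Fin k → Carrier) → ℕ → Carrier
  pick zero    f u       = 0#
  pick (suc k) f zero    = f zero
  pick (suc k) f (suc u) = pick k (λ i → f (suc i)) u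

  Σ-pick : ∀ k u (f : Fin k → Carrier) → Σ[ k ] (λ e → δℕ u (toℕ e) * f e) ≈ pick k f u
  Σ-pick zero    u       f = refl
  Σ-pick (suc k) zero    f = trans (+-cong (*-identityˡ _) (Σ-zero k (λ e → zeroˡ _))) (+-identityʳ _)
  Σ-pick (suc k) (suc u) f = trans (+-cong (zeroˡ _) (Σ-pick k u (λ e → f (suc e)))) (+-identityˡ _)

  pick-toℕ : ∀ k (f : Fin k → Carrier) (i : Fin k) → pick k f (toℕ i) ≡ f i
  pick-toℕ (suc k) f zero    = ≡.refl
  pick-toℕ (suc k) f (suc i) = pick-toℕ k (λ j → f (suc j)) i

  pick-< : ∀ j (F : ℕ → Carrier) u → u ℕ.< j → pick j (λ t → F (toℕ t)) u ≡ F u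
  pick-< (suc j) F zero    _           = ≡.refl
  pick-< (suc j) F (suc u) (ℕ.s≤s u<j) = pick-< j (λ v → F (suc v)) u u<j

  pick-≥ : ∀ k (f : Fin k → Carrier) u → k ℕ.≤ u → pick k f u ≡ 0#
  pick-≥ zero    f u       _           = ≡.refl
  pick-≥ (suc k) f (suc u) (ℕ.s≤s k≤u) = pick-≥ k (λ i → f (suc i)) u k≤u

  pick-zero : ∀ k u (f : Fin k → Carrier) → (∀ i → toℕ i ≡ u → f i ≈ 0#) → pick k f u ≈ 0#
  pick-zero zero    u       f z = refl
  pick-zero (suc k) zero    f z = z zero ≡.refl
  pick-zero (suc k) (suc u) f z = pick-zero k u (λ i → f (suc i)) (λ i eq → z (suc i) (≡.cong suc eq))

  corner : ∀ j {k} → Mat k k → Mat j j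
  corner j {k} X = η j k ⊛ X ⊛ η j k †

  η†η-⊛ : ∀ j k {n} (X : Mat k n) a b →
          (η j k † ⊛ (η j k ⊛ X)) a b ≈ pick j (λ t → pick k (λ e → X e b) (toℕ t)) (toℕ a)
  η†η-⊛ j k X a b = trans
    (Σ-cong j (λ t → *-cong (trans (conj-δ _) (reflexive (δℕ-sym (toℕ t) (toℕ a)))) (Σ-pick k (toℕ t) _)))
    (Σ-pick j (toℕ a) _)

  η†η-below : ∀ j k {n} (X : Mat k n) a b → toℕ a ℕ.< j → (η j k † ⊛ (η j k ⊛ X)) a b ≈ X a b
  η†η-below j k X a b a<j = trans (η†η-⊛ j k X a b)
    (reflexive (≡.trans (pick-< j (λ u → pick k (λ e → X e b) u) (toℕ a) a<j) (pick-toℕ k _ a)))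

  η†η-above : ∀ j k {n} (X : Mat k n) a b → j ℕ.≤ toℕ a → (η j k † ⊛ (η j k ⊛ X)) a b ≈ 0#
  η†η-above j k X a b j≤a = trans (η†η-⊛ j k X a b) (reflexive (pick-≥ j _ (toℕ a) j≤a))

  upper-⊛η† : ∀ j k (g : Mat k k) → UpperTriangular g → ∀ a b → j ℕ.≤ toℕ a → (g ⊛ η j k †) a b ≈ 0#
  upper-⊛η† j k g ut a b j≤a = trans
    (Σ-cong k (λ c → trans (*-congˡ (conj-δ _)) (*-comm _ _)))
    (trans (Σ-pick k (toℕ b) (g a)) (pick-zero k (toℕ b) (g a) (λ c c≡b →
      ut a c (ℕₚ.<-≤-trans (≡.subst (ℕ._< j) (≡.sym c≡b) (toℕ<n b)) j≤a))))

  -- The span of the first j basis vectors is invariant under an upper-triangular g: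
  -- η† (corner g) = g η†.
  corner-invariant : ∀ j k (g : Mat k k) → UpperTriangular g → η j k † ⊛ corner j g ≈M g ⊛ η j k †
  corner-invariant j k g ut = ≈M.trans (⊛-cong j ≈M.refl (⊛-assoc (η j k) g (η j k †))) restrict
    where
    restrict : η j k † ⊛ (η j k ⊛ (g ⊛ η j k †)) ≈M g ⊛ η j k †
    restrict a b with toℕ a ℕ.<? j
    ... | yes a<j = η†η-below j k (g ⊛ η j k †) a b a<j
    ... | no  a≮j = trans (η†η-above j k (g ⊛ η j k †) a b (ℕₚ.≮⇒≥ a≮j))
                          (sym (upper-⊛η† j k g ut a b (ℕₚ.≮⇒≥ a≮j)))

  corner-twist : ∀ j k (g Z : Mat k k) → UpperTriangular g →
                 corner j g † ⊛ corner j Z ⊛ corner j g ≈M corner j (g † ⊛ Z ⊛ g)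
  corner-twist j k g Z ut = sandwich-slide {m₂ = j} {m₅ = j} {k₁ = k} {k₂ = k}
    (intertwine-† (η j k) (corner j g) g (corner-invariant j k g ut))
    (corner-invariant j k g ut)

  G-twist : ∀ {k} (λs : Vec ℕ k) (g Z : Mat k k) → UpperTriangular g →
            G λs g † ⊛ G λs Z ⊛ G λs g ≈M G λs (g † ⊛ Z ⊛ g)
  G-twist {k} λs g Z ut = ≈M.trans
    (blockDiag-sandwich ds (λ i → corner (lookup ds i) g) (λ i → corner (lookup ds i) Z))
    (blockDiag-cong ds (λ i → corner-twist (lookup ds i) k g Z ut))
    where ds = conjList λs

  G-cong : ∀ {k} (λs : Vec ℕ k) {X X' : Mat k k} → X ≈M X' → G λs X ≈M G λs X'
  G-cong {k} λs e = blockDiag-cong (conjList λs) (λ i → ⊛-cong k (⊛-cong k ≈M.refl e) ≈M.refl)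

  intertwine-⊛ : ∀ {m n p} (A : Mat m n) (B : Mat n p) {M : Mat m m} {N : Mat n n} {g : Mat p p} →
    A † ⊛ M ≈M N ⊛ A † → B † ⊛ N ≈M g ⊛ B † → (A ⊛ B) † ⊛ M ≈M g ⊛ (A ⊛ B) †
  intertwine-⊛ {m} {n} {p} A B {M} {N} {g} am bn = begin
    (A ⊛ B) † ⊛ M     ≈⟨ ⊛-cong m (†-⊛ A B) ≈M.refl ⟩
    B † ⊛ A † ⊛ M     ≈⟨ ⊛-assoc (B †) (A †) M ⟩
    B † ⊛ (A † ⊛ M)   ≈⟨ ⊛-cong n ≈M.refl am ⟩
    B † ⊛ (N ⊛ A †)   ≈⟨ ⊛-assoc (B †) N (A †) ⟨
    B † ⊛ N ⊛ A †     ≈⟨ ⊛-cong n bn ≈M.refl ⟩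
    g ⊛ B † ⊛ A †     ≈⟨ ⊛-assoc g (B †) (A †) ⟩
    g ⊛ (B † ⊛ A †)   ≈⟨ ⊛-cong p ≈M.refl (†-⊛ A B) ⟨
    g ⊛ (A ⊛ B) †     ∎
    where open MatReasoning

  Gkraus-intertwine : ∀ {k} (λs : Vec ℕ k) (h : Mat k k) → UpperTriangular h → ∀ i →
                      Gkraus λs i † ⊛ G λs h ≈M h ⊛ Gkraus λs i †
  Gkraus-intertwine {k} λs h ut i = intertwine-⊛ (ι ds i) (η (lookup ds i) k)
    (ι-intertwine ds (λ l → corner (lookup ds l) h) i)
    (corner-invariant (lookup ds i) k h ut)
    where ds = conjList λs

  ΣM-sandwich : ∀ r {m n} (A : Mat m n) (F : Fin r → Mat n n) →
                ΣM[ r ] (λ s → A ⊛ F s ⊛ A †) ≈M A ⊛ ΣM[ r ] F ⊛ A †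
  ΣM-sandwich r {n = n} A F = ≈M.sym (≈M.trans
    (⊛-cong n (⊛-ΣMˡ r A F) ≈M.refl)
    (ΣM-⊛ʳ r (λ s → A ⊛ F s) (A †)))

  G*-twist : ∀ {k} (λs : Vec ℕ k) (h : Mat k k) → UpperTriangular h → ∀ Y →
             G* λs (G λs h ⊛ Y ⊛ G λs h †) ≈M h ⊛ G* λs Y ⊛ h †
  G*-twist {k} λs h ut Y = ≈M.trans
    (ΣM-cong r (λ i → sandwich-slide {m₂ = S} {m₅ = S} {k₁ = k} {k₂ = k} (Gkraus-intertwine λs h ut i)
      (intertwine-† (Gkraus λs i) (G λs h) h (Gkraus-intertwine λs h ut i))))
    (ΣM-sandwich r h (λ i → Gkraus λs i † ⊛ Y ⊛ Gkraus λs i))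
    where r = length (conjList λs)
          S = sumL (conjList λs)

  kraus-cong : ∀ {n m} (T : Mat n n → Mat m m) → CompletelyPositive T →
               ∀ {X X'} → X ≈M X' → T X ≈M T X'
  kraus-cong {n} T (r , A , kraus) {X} {X'} e = begin
    T X                               ≈⟨ kraus X ⟩
    ΣM[ r ] (λ s → A s ⊛ X ⊛ A s †)   ≈⟨ ΣM-cong r (λ s → ⊛-cong n (⊛-cong n ≈M.refl e) ≈M.refl) ⟩
    ΣM[ r ] (λ s → A s ⊛ X' ⊛ A s †)  ≈⟨ kraus X' ⟨
    T X'                              ∎
    where open MatReasoning

mainTheorem14 : ∀ {c ℓ} (R : StarCommRing c ℓ) → let open MatOps R in
    ∀ {n m N : ℕ} (p : Vec ℕ n) (q : Vec ℕ m) →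
    NonIncreasing p → NonIncreasing q → sum p ≡ N → sum q ≡ N →
    (T : Mat n n → Mat m m) → CompletelyPositive T →
    (g₀ : Mat m m) → UpperTriangular g₀ → Invertible g₀ →
    (h₀ : Mat n n) → UpperTriangular h₀ → Invertible h₀ →
    ∀ Y → trun p q (twist T g₀ h₀) Y ≈M twist (trun p q T) (G q g₀) (G p h₀) Y
mainTheorem14 R p q _ _ _ _ T cp g₀ g₀-upper _ h₀ h₀-upper _ Y = begin
  G q (g₀ † ⊛ T (h₀ ⊛ G* p Y ⊛ h₀ †) ⊛ g₀)
    ≈⟨ G-twist q g₀ _ g₀-upper ⟨
  G q g₀ † ⊛ G q (T (h₀ ⊛ G* p Y ⊛ h₀ †)) ⊛ G q g₀
    ≈⟨ ⊛-cong S (⊛-cong S ≈M.refl (G-cong q (kraus-cong T cp (G*-twist p h₀ h₀-upper Y)))) ≈M.refl ⟨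
  G q g₀ † ⊛ G q (T (G* p (G p h₀ ⊛ Y ⊛ G p h₀ †))) ⊛ G q g₀ ∎
  where
  open MatOps R
  open Truncation R
  open MatReasoning
  S = sumL (conjList q)
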